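{- Let $d \geq 1$ and $n \geq 1$. If a set of $m$ queens is placed in the $d$-dimensional chess space of size $n$ such that every board position is attacked by at least one of the queens, then \[ m \geq \frac{2 n^{d-1}}{3^d - 1}. \] That is, the least number of queens necessary to attack all positions is no less than $\frac{2 n^{d-1}}{3^d - 1}$.
   Context: A $d$-dimensional chess space of size $n$ is the set of $n^d$ positions $\{0,1,\ldots,n-1\}^d$. A queen at position $q$ attacks a position $x$ of the board if $x = q + s\delta$ for some integer $s$ and some $\delta \in \{ -1,0,1\}^d$ other than the zero vector (in particular a queen attacks the position it occupies). -}

module Defs where

open import Data.Nat using (ℕ)
open import Data.Fin using (Fin; toℕ)
open import Data.Integer using (ℤ; +_; -[1+_]; _+_; _*_)
open import Data.Product using (Σ; _×_; ∃)
open import Data.Sum using (_⊎_)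
open import Relation.Binary.PropositionalEquality using (_≡_)
open import Relation.Nullary using (¬_)

Position : ℕ → ℕ → Set
Position d n = Fin d → Fin n

IsUnitStep : ℤ → Set
IsUnitStep z = (z ≡ -[1+ 0 ]) ⊎ ((z ≡ + 0) ⊎ (z ≡ + 1))

IsDirection : (d : ℕ) → (Fin d → ℤ) → Set
IsDirection d δ = ((i : Fin d) → IsUnitStep (δ i)) × ¬ ((i : Fin d) → δ i ≡ + 0)

Attacks : {d n : ℕ} → Position d n → Position d n → Set
Attacks {d} {n} q x =
  Σ ℤ λ s → Σ (Fin d → ℤ) λ δ →
    IsDirection d δ × ((i : Fin d) → + toℕ (x i) ≡ + toℕ (q i) + s * δ i)

-- Every line of the board is spanned by exactly one direction whose first nonzero coordinate is +1,
-- and there are (3^d - 1)/2 such directions.  Hence m queens lie on at most m (3^d - 1)/2 lines, and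
-- covering the board means these lines contain all n^d positions.  A line meets the board in at most
-- n positions, because along a direction δ with δ p = 1 a position is determined by its coordinate p.
-- So n^d ≤ n m (3^d - 1)/2.
module Submission where

open import Defs
open import Data.Nat using (ℕ; zero; suc; _+_; _≤_; _*_; _^_; _∸_; NonZero)
import Data.Nat.Properties as ℕ
open import Data.Nat.Tactic.RingSolver using (solve-∀)
open import Algebra.Properties.CommutativeSemigroup ℕ.*-commutativeSemigroup using (x∙yz≈y∙xz)
open import Data.Integer as ℤ using (ℤ; +_; -[1+_]; -_)
import Data.Integer.Properties as ℤ
open import Algebra.Properties.Ring ℤ.+-*-ring using (+-cancelˡ)
open import Data.Fin using (Fin; zero; suc; toℕ; finToFun; funToFin; combine; splitAt; _↑ˡ_; _↑ʳ_)
import Data.Fin.Properties as Fin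
open import Data.Vec.Functional using (Vector; _∷_)
open import Data.List using (List; length; lookup)
open import Data.List.Membership.Propositional using (_∈_)
open import Data.List.Relation.Unary.Unique.Propositional using (Unique)
import Data.List.Relation.Unary.Any as Any
import Data.List.Relation.Unary.Any.Properties as Any
open import Data.Product using (Σ; Σ-syntax; _×_; _,_)
open import Data.Sum using (inj₁; inj₂; [_,_]′)
open import Data.Empty using (⊥-elim)
open import Function using (_∘_; const)
open import Relation.Binary.PropositionalEquality
  using (_≡_; refl; sym; trans; cong; cong₂; cong-app; subst; _≗_; module ≡-Reasoning)

funToFin-cong : ∀ {d n} {f g : Fin d → Fin n} → f ≗ g → funToFin f ≡ funToFin g
funToFin-cong {zero}  f≗g = refl
funToFin-cong {suc d} f≗g = cong₂ combine (f≗g zero) (funToFin-cong (f≗g ∘ suc))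

unitStep : Fin 3 → ℤ
unitStep zero             = -[1+ 0 ]
unitStep (suc zero)       = + 0
unitStep (suc (suc zero)) = + 1

unitStepIndex : ℤ → Fin 3
unitStepIndex -[1+ _ ]    = zero
unitStepIndex (+ zero)    = suc zero
unitStepIndex (+ suc _)   = suc (suc zero)

unitStep-unitStepIndex : ∀ {z} → IsUnitStep z → unitStep (unitStepIndex z) ≡ z
unitStep-unitStepIndex (inj₁ refl)        = refl
unitStep-unitStepIndex (inj₂ (inj₁ refl)) = refl
unitStep-unitStepIndex (inj₂ (inj₂ refl)) = refl

neg-isUnitStep : ∀ {z} → IsUnitStep z → IsUnitStep (- z)
neg-isUnitStep (inj₁ refl)        = inj₂ (inj₂ refl)
neg-isUnitStep (inj₂ (inj₁ refl)) = inj₂ (inj₁ refl)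
neg-isUnitStep (inj₂ (inj₂ refl)) = inj₁ refl

#lines : ℕ → ℕ
#lines zero    = 0
#lines (suc d) = 3 ^ d + #lines d

suc[2*#lines]≡3^ : ∀ d → suc (2 * #lines d) ≡ 3 ^ d
suc[2*#lines]≡3^ zero    = refl
suc[2*#lines]≡3^ (suc d) = begin
  suc (2 * (3 ^ d + #lines d))   ≡⟨ regroup (3 ^ d) (#lines d) ⟩
  2 * 3 ^ d + suc (2 * #lines d) ≡⟨ cong (_+_ (2 * 3 ^ d)) (suc[2*#lines]≡3^ d) ⟩
  2 * 3 ^ d + 3 ^ d              ≡⟨ twice+once (3 ^ d) ⟩
  3 * 3 ^ d                      ∎
  where
  open ≡-Reasoning
  regroup : ∀ a l → suc (2 * (a + l)) ≡ 2 * a + suc (2 * l)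
  regroup = solve-∀
  twice+once : ∀ a → 2 * a + a ≡ 3 * a
  twice+once = solve-∀

-- In dimension suc d, the index a ↑ˡ _ stands for the direction (1, a) with a ∈ {-1,0,1}^d read
-- through finToFun, and 3 ^ d ↑ʳ k for the direction (0, k).
lineDirection : ∀ {d} → Fin (#lines d) → Vector ℤ d
lineDirection {suc d} k = [ (λ a → + 1 ∷ unitStep ∘ finToFun a) , (λ k → + 0 ∷ lineDirection {d} k) ]′
                            (splitAt (3 ^ d) k)

lineDirection-↑ˡ : ∀ {d} (a : Fin (3 ^ d)) →
                   lineDirection {suc d} (a ↑ˡ #lines d) ≡ + 1 ∷ unitStep ∘ finToFun a
lineDirection-↑ˡ {d} a = cong [ _ , _ ]′ (Fin.splitAt-↑ˡ (3 ^ d) a (#lines d))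

lineDirection-↑ʳ : ∀ {d} (k : Fin (#lines d)) →
                   lineDirection {suc d} (3 ^ d ↑ʳ k) ≡ + 0 ∷ lineDirection {d} k
lineDirection-↑ʳ {d} k = cong [ _ , _ ]′ (Fin.splitAt-↑ʳ (3 ^ d) (#lines d) k)

pivot : ∀ {d} → Fin (#lines d) → Fin d
pivot {suc d} k = [ const zero , suc ∘ pivot {d} ]′ (splitAt (3 ^ d) k)

lineDirection-pivot : ∀ {d} (k : Fin (#lines d)) → lineDirection {d} k (pivot {d} k) ≡ + 1
lineDirection-pivot {suc d} k with splitAt (3 ^ d) k
... | inj₁ a = refl
... | inj₂ k = lineDirection-pivot {d} k

leading1⇒lineDirection : ∀ {d} (ε : Vector ℤ (suc d)) → (∀ i → IsUnitStep (ε i)) → ε zero ≡ + 1 →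
                         Σ[ k ∈ Fin (#lines (suc d)) ] ε ≗ lineDirection {suc d} k
leading1⇒lineDirection {d} ε units ε₀≡1 =
  a ↑ˡ #lines d , λ i → trans (ε≗ i) (sym (cong-app (lineDirection-↑ˡ {d} a) i))
  where
  a = funToFin (unitStepIndex ∘ ε ∘ suc)
  ε≗ : ε ≗ + 1 ∷ unitStep ∘ finToFun a
  ε≗ zero    = ε₀≡1
  ε≗ (suc i) = sym (trans (cong unitStep (Fin.finToFun-funToFin (unitStepIndex ∘ ε ∘ suc) i))
                          (unitStep-unitStepIndex (units (suc i))))

direction⇒line : ∀ {d δ} → IsDirection d δ →
                 Σ[ k ∈ Fin (#lines d) ] Σ[ σ ∈ ℤ ] (∀ i → δ i ≡ σ ℤ.* lineDirection {d} k i)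
direction⇒line {zero}      (_ , nonzero) = ⊥-elim (nonzero λ ())
direction⇒line {suc d} {δ} (units , nonzero) with units zero
... | inj₂ (inj₂ δ₀≡1) =
  let k , δ≗ = leading1⇒lineDirection δ units δ₀≡1 in
  k , + 1 , λ i → trans (δ≗ i) (sym (ℤ.*-identityˡ _))
... | inj₁ δ₀≡-1 =
  let k , -δ≗ = leading1⇒lineDirection (-_ ∘ δ) (neg-isUnitStep ∘ units) (cong -_ δ₀≡-1) in
  k , -[1+ 0 ] , λ i → trans (sym (ℤ.neg-involutive (δ i)))
                             (trans (cong -_ (-δ≗ i)) (sym (ℤ.-1*i≡-i _)))
... | inj₂ (inj₁ δ₀≡0) =
  let k , σ , δ≗ = direction⇒line (units ∘ suc , λ tail≡0 →
                                     nonzero λ { zero → δ₀≡0 ; (suc i) → tail≡0 i })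
      δ≗′ : ∀ i → δ i ≡ σ ℤ.* (+ 0 ∷ lineDirection {d} k) i
      δ≗′ = λ { zero → trans δ₀≡0 (sym (ℤ.*-zeroʳ σ)) ; (suc i) → δ≗ i }
  in 3 ^ d ↑ʳ k , σ ,
     λ i → trans (δ≗′ i) (cong (λ ℓ → σ ℤ.* ℓ i) (sym (lineDirection-↑ʳ {d} k)))

finToFun-injective : ∀ {n d} {i j : Fin (n ^ d)} → finToFun {n} {d} i ≗ finToFun j → i ≡ j
finToFun-injective {n} {d} {i} {j} i≗j = begin
  i                              ≡⟨ Fin.funToFin-finToFin {d} {n} i ⟨
  funToFin (finToFun {n} {d} i) ≡⟨ funToFin-cong i≗j ⟩
  funToFin (finToFun {n} {d} j) ≡⟨ Fin.funToFin-finToFin {d} {n} j ⟩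
  j                              ∎
  where open ≡-Reasoning

OnLine : ∀ {d n} → Position d n → Fin (#lines d) → Position d n → Set
OnLine {d} q k x = Σ[ t ∈ ℤ ] (∀ i → + toℕ (x i) ≡ + toℕ (q i) ℤ.+ t ℤ.* lineDirection {d} k i)

attacks⇒onLine : ∀ {d n} {q x : Position d n} → Attacks q x → Σ[ k ∈ Fin (#lines d) ] OnLine q k x
attacks⇒onLine {d} {q = q} (s , δ , isDirection , x≡q+sδ) =
  let k , σ , δ≡σℓ = direction⇒line isDirection in
  k , s ℤ.* σ , λ i → trans (x≡q+sδ i)
    (cong (ℤ._+_ (+ toℕ (q i))) (trans (cong (s ℤ.*_) (δ≡σℓ i)) (sym (ℤ.*-assoc s σ _))))

onLine-pivot-injective : ∀ {d n} {q x y : Position d n} {k} → OnLine q k x → OnLine q k y →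
                         x (pivot {d} k) ≡ y (pivot {d} k) → x ≗ y
onLine-pivot-injective {d} {q = q} {k = k} (t , x≡) (u , y≡) xₚ≡yₚ i =
  Fin.toℕ-injective (ℤ.+-injective (begin
    + toℕ _                           ≡⟨ x≡ i ⟩
    + toℕ (q i) ℤ.+ t ℤ.* ℓ i         ≡⟨ cong (λ s → + toℕ (q i) ℤ.+ s ℤ.* ℓ i) t≡u ⟩
    + toℕ (q i) ℤ.+ u ℤ.* ℓ i         ≡⟨ y≡ i ⟨
    + toℕ _                           ∎))
  where
  open ≡-Reasoning
  ℓ = lineDirection {d} k
  p = pivot {d} k
  tℓₚ≡uℓₚ : t ℤ.* ℓ p ≡ u ℤ.* ℓ p
  tℓₚ≡uℓₚ = +-cancelˡ (+ toℕ (q p)) _ _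
              (trans (sym (x≡ p)) (trans (cong (λ z → + toℕ z) xₚ≡yₚ) (y≡ p)))
  t≡u : t ≡ u
  t≡u = begin
    t            ≡⟨ ℤ.*-identityʳ t ⟨
    t ℤ.* + 1    ≡⟨ subst (λ c → t ℤ.* c ≡ u ℤ.* c) (lineDirection-pivot {d} k) tℓₚ≡uℓₚ ⟩
    u ℤ.* + 1    ≡⟨ ℤ.*-identityʳ u ⟩
    u            ∎

LineCover : ∀ {d n m} → (Fin m → Position d n) → Set
LineCover {d} {n} base = ∀ (x : Position d n) → Σ[ i ∈ Fin _ ] Σ[ k ∈ Fin (#lines d) ] OnLine (base i) k x

lineCover⇒n^d≤m*#lines*n : ∀ {d n m} (base : Fin m → Position d n) → LineCover base →
                            n ^ d ≤ m * #lines d * n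
lineCover⇒n^d≤m*#lines*n {d} {n} {m} base cover =
  Fin.injective⇒≤ {f = code ∘ finToFun}
    λ {i} {j} → finToFun-injective {n} {d} ∘ encode-injective (cover (finToFun i)) (cover (finToFun j))
  where
  CoveringLine : Position d n → Set
  CoveringLine x = Σ[ i ∈ Fin m ] Σ[ k ∈ Fin (#lines d) ] OnLine (base i) k x
  encode : ∀ x → CoveringLine x → Fin (m * #lines d * n)
  encode x (i , k , _) = combine (combine i k) (x (pivot {d} k))
  encode-injective : ∀ {x y} (cx : CoveringLine x) (cy : CoveringLine y) → encode x cx ≡ encode y cy → x ≗ y
  encode-injective {x} {y} (i , k , x∈ℓ) (j , l , y∈ℓ) eq
    with ik≡jl , xₖ≡yₗ ← Fin.combine-injective (combine i k) (x (pivot {d} k))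
                                                (combine j l) (y (pivot {d} l)) eq
    with refl , refl ← Fin.combine-injective i k j l ik≡jl
    = onLine-pivot-injective x∈ℓ y∈ℓ xₖ≡yₗ
  code : Position d n → Fin (m * #lines d * n)
  code x = encode x (cover x)

queenCover⇒lineCover : ∀ {d n} (Q : List (Position d n)) →
                       ((x : Position d n) → Σ (Position d n) λ q → (q ∈ Q) × Attacks q x) →
                       LineCover (lookup Q)
queenCover⇒lineCover Q cover x =
  let q , q∈Q , q-attacks-x = cover x
      k , x∈ℓ = attacks⇒onLine q-attacks-x
  in Any.index q∈Q , k , subst (λ q → OnLine q k x) (Any.lookup-index q∈Q) x∈ℓ

theorem2 : (d n : ℕ) → .{{_ : NonZero d}} → .{{_ : NonZero n}} →
           (Q : List (Position d n)) → Unique Q →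
           ((x : Position d n) → Σ (Position d n) λ q → (q ∈ Q) × Attacks q x) →
           2 * n ^ (d ∸ 1) ≤ length Q * (3 ^ d ∸ 1)
theorem2 (suc d) n Q _ cover = begin
  2 * n ^ d                     ≤⟨ ℕ.*-monoʳ-≤ 2 n^d≤m*#lines ⟩
  2 * (m * #lines (suc d))      ≡⟨ x∙yz≈y∙xz 2 m (#lines (suc d)) ⟩
  m * (2 * #lines (suc d))      ≡⟨ cong (λ l → m * (l ∸ 1)) (suc[2*#lines]≡3^ (suc d)) ⟩
  m * (3 ^ suc d ∸ 1)           ∎
  where
  open ℕ.≤-Reasoning
  m = length Q
  n^d≤m*#lines : n ^ d ≤ m * #lines (suc d)
  n^d≤m*#lines = ℕ.*-cancelʳ-≤ _ _ n (begin
    n ^ d * n                   ≡⟨ ℕ.*-comm (n ^ d) n ⟩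
    n ^ suc d                   ≤⟨ lineCover⇒n^d≤m*#lines*n (lookup Q) (queenCover⇒lineCover Q cover) ⟩
    m * #lines (suc d) * n      ∎)
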